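{- Let $E$ and $E'$ be $\mathcal{E}$-formulas over $L$ and $X$ a finite set of variables. (1) If $E\preceq E'$, then $E|_X\preceq E'|_X$. (2) If $E\approx E'$, then $E|_X\approx E'|_X$.
   Context: $L$ is a first-order language with equality whose function symbols include at least one constant; variables form a fixed enumerated set $\mathit{Var}$. $\mathrm{FEA}(L)$ (free equality axioms): $f(\bar x)=f(\bar y)\leftrightarrow x_1=y_1\wedge\dots\wedge x_n=y_n$ for each $n$-ary $f$; $f(\bar x)=g(\bar y)\leftrightarrow\mathit{False}$ for distinct $f,g$; $x=t\leftrightarrow\mathit{False}$ whenever $x\not\equiv t$ occurs in $t$. An $\mathcal{E}$-formula is built from $\mathit{True}$, $\mathit{False}$ and equations using only $\wedge$ and $\exists$. $E\preceq E'$ iff $\mathrm{FEA}(L)\models E\rightarrow E'$; $E\approx E'$ iff $\mathrm{FEA}(L)\models E\leftrightarrow E'$. $\mathrm{vars}(E)$ is the set of free variables of $E$. Projection: for $E\not\equiv\mathit{False}$, if $\{z_1,\dots,z_k\}=\mathrm{vars}(E)\setminus X$ with $z_1,\dots,z_k$ listed in the order of $\mathit{Var}$, then $E|_X$ is $(\exists z_1)\dots(\exists z_k)E$; and $\mathit{False}|_X=\mathit{False}$. -}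

module Defs where

open import Data.Nat using (ℕ; zero; suc; _≟_; _⊔_)
open import Data.Vec using (Vec; []; _∷_)
open import Data.List using (List; []; _∷_; _++_; filter; upTo; foldr)
open import Data.List.Membership.DecPropositional _≟_ using (_∈?_)
open import Data.Product using (Σ; ∃; _×_; _,_)
open import Data.Unit using (⊤)
open import Data.Empty using (⊥)
open import Relation.Nullary using (¬_; _×-dec_; ¬?)
open import Relation.Binary.PropositionalEquality using (_≡_; _≢_)

-- Variables: the fixed enumerated set Var is ℕ (enumeration order = ≤ on ℕ).
Var : Set
Var = ℕ

-- A first-order language with equality: function symbols with arities,
-- containing at least one constant.  (Predicate symbols play no role for
-- E-formulas and are omitted.)
record Language : Set₁ where
  field
    Fun      : Set
    arity    : Fun → ℕ
    constant : Σ Fun (λ c → arity c ≡ 0)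

module _ (L : Language) where
  open Language L

  data Term : Set where
    var : Var → Term
    app : (f : Fun) → Vec Term (arity f) → Term

  mutual
    data _occursIn_ (x : Var) : Term → Set where
      here  : x occursIn var x
      there : ∀ {f ts} → x occursInVec ts → x occursIn app f ts

    data _occursInVec_ (x : Var) : ∀ {n} → Vec Term n → Set where
      hd : ∀ {n t} {ts : Vec Term n} → x occursIn t → x occursInVec (t ∷ ts)
      tl : ∀ {n t} {ts : Vec Term n} → x occursInVec ts → x occursInVec (t ∷ ts)

  data EForm : Set where
    true  : EForm
    false : EForm
    _≐_   : Term → Term → EForm
    _∧_   : EForm → EForm → EForm
    ex    : Var → EForm → EForm

  record Structure : Set₁ where
    field
      Dom    : Set
      interp : (f : Fun) → Vec Dom (arity f) → Dom

  module _ (M : Structure) where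
    open Structure M

    Env : Set
    Env = Var → Dom

    mutual
      eval : Env → Term → Dom
      eval ρ (var x)    = ρ x
      eval ρ (app f ts) = interp f (evalVec ρ ts)

      evalVec : ∀ {n} → Env → Vec Term n → Vec Dom n
      evalVec ρ []       = []
      evalVec ρ (t ∷ ts) = eval ρ t ∷ evalVec ρ ts

    update : Env → Var → Dom → Env
    update ρ x d y with y ≟ x
    ... | Relation.Nullary.yes _ = d
    ... | Relation.Nullary.no _  = ρ y

    Sat : Env → EForm → Set
    Sat ρ true      = ⊤
    Sat ρ false     = ⊥
    Sat ρ (s ≐ t)   = eval ρ s ≡ eval ρ t
    Sat ρ (E ∧ F)   = Sat ρ E × Sat ρ F
    Sat ρ (ex x E)  = ∃ λ d → Sat (update ρ x d) E

    -- M is a model of FEA(L) (each axiom universally closed).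
    record ModelOfFEA : Set where
      field
        fea-inj  : ∀ f (ρ : Env) (xs ys : Vec Term (arity f)) →
                   (eval ρ (app f xs) ≡ eval ρ (app f ys)) → evalVec ρ xs ≡ evalVec ρ ys
        fea-clash : ∀ f g → f ≢ g → (ρ : Env) (xs : Vec Term (arity f)) (ys : Vec Term (arity g)) →
                   eval ρ (app f xs) ≢ eval ρ (app g ys)
        fea-occur : ∀ (x : Var) (t : Term) → x occursIn t → t ≢ var x →
                   (ρ : Env) → ρ x ≢ eval ρ t

  _⪯_ : EForm → EForm → Set₁
  E ⪯ E' = (M : Structure) → ModelOfFEA M → (ρ : Env M) → Sat M ρ E → Sat M ρ E'

  _≈_ : EForm → EForm → Set₁
  E ≈ E' = (M : Structure) → ModelOfFEA M → (ρ : Env M) →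
           (Sat M ρ E → Sat M ρ E') × (Sat M ρ E' → Sat M ρ E)

  -- free variables (as a list, possibly with repetitions)
  mutual
    tvars : Term → List Var
    tvars (var x)    = x ∷ []
    tvars (app f ts) = tvarsVec ts

    tvarsVec : ∀ {n} → Vec Term n → List Var
    tvarsVec []       = []
    tvarsVec (t ∷ ts) = tvars t ++ tvarsVec ts

  remove : Var → List Var → List Var
  remove x = filter (λ y → ¬? (y ≟ x))

  vars : EForm → List Var
  vars true     = []
  vars false    = []
  vars (s ≐ t)  = tvars s ++ tvars t
  vars (E ∧ F)  = vars E ++ vars F
  vars (ex x E) = remove x (vars E)

  bound : List Var → ℕ
  bound []       = 0
  bound (x ∷ xs) = suc x ⊔ bound xs

  -- vars(E) \ X, listed without repetition in the order of Var
  projVars : EForm → List Var → List Var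
  projVars E X = filter (λ z → (z ∈? vars E) ×-dec ¬? (z ∈? X)) (upTo (bound (vars E)))

  _∣_ : EForm → List Var → EForm
  false ∣ X = false
  E     ∣ X = foldr ex E (projVars E X)

{-# OPTIONS --safe #-}
-- A witness
-- environment for E|_X satisfies E, hence E', and it agrees with the given
-- environment on every variable of E' that E'|_X leaves free: such a variable
-- lies in X, so E|_X did not quantify it.  No axiom of FEA(L) is used beyond
-- the hypothesis E ⪯ E' itself.
module Submission where

open import Defs
open import Data.Nat using (ℕ; suc; _<_; _≟_)
open import Data.Nat.Properties using (m≤m⊔n; m≤n⊔m; <-≤-trans)
open import Data.List using (List; []; _∷_; _++_; foldr; upTo)
open import Data.List.Relation.Unary.Any using (here; there)
open import Data.List.Membership.Propositional using (_∈_; _∉_)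
open import Data.List.Membership.Propositional.Properties
  using (∈-++⁺ˡ; ∈-++⁺ʳ; ∈-filter⁺; ∈-filter⁻; ∈-upTo⁺)
open import Data.List.Membership.DecPropositional _≟_ using (_∈?_)
open import Data.Vec using (Vec; []; _∷_)
open import Data.Product using (∃; _×_; _,_; proj₁; proj₂)
open import Data.Unit using (tt)
open import Data.Empty using (⊥-elim)
open import Function using (_∘_)
open import Relation.Nullary using (yes; no; ¬_; ¬?; _×-dec_)
open import Relation.Binary.PropositionalEquality using (_≡_; refl; sym; trans; cong; cong₂)

module _ (L : Language) where

  ∈⇒<bound : ∀ {y} xs → y ∈ xs → y < bound L xs
  ∈⇒<bound (x ∷ xs) (here refl) = m≤m⊔n (suc x) (bound L xs)
  ∈⇒<bound (x ∷ xs) (there p)   = <-≤-trans (∈⇒<bound xs p) (m≤n⊔m (suc x) (bound L xs))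

  exs : List Var → EForm L → EForm L
  exs zs E = foldr (ex {L}) E zs

  -- For E = false both sides are false, since projVars false X = [].
  ∣≡exs-projVars : ∀ E X → _∣_ L E X ≡ exs (projVars L E X) E
  ∣≡exs-projVars true     X = refl
  ∣≡exs-projVars false    X = refl
  ∣≡exs-projVars (s ≐ t)  X = refl
  ∣≡exs-projVars (E ∧ F)  X = refl
  ∣≡exs-projVars (ex x E) X = refl

  ∈-projVars : ∀ E {X y} → y ∈ vars L E → y ∉ X → y ∈ projVars L E X
  ∈-projVars E {X} p y∉X =
    ∈-filter⁺ (λ z → (z ∈? vars L E) ×-dec ¬? (z ∈? X)) (∈-upTo⁺ (∈⇒<bound (vars L E) p)) (p , y∉X)

  ∈-projVars⇒∉ : ∀ E {X y} → y ∈ projVars L E X → y ∉ X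
  ∈-projVars⇒∉ E {X} p =
    proj₂ (proj₂ (∈-filter⁻ (λ z → (z ∈? vars L E) ×-dec ¬? (z ∈? X))
                            {xs = upTo (bound L (vars L E))} p))

  projVars-transfer : ∀ E E' {X y} → y ∈ vars L E' → y ∈ projVars L E X → y ∈ projVars L E' X
  projVars-transfer E E' p q = ∈-projVars E' p (∈-projVars⇒∉ E q)

  module _ (M : Structure L) where
    open Structure M

    Agree : Env L M → Env L M → List Var → Set
    Agree ρ σ xs = ∀ {y} → y ∈ xs → ρ y ≡ σ y

    Agree-++ˡ : ∀ {ρ σ} xs {ys} → Agree ρ σ (xs ++ ys) → Agree ρ σ xs
    Agree-++ˡ xs h p = h (∈-++⁺ˡ p)

    Agree-++ʳ : ∀ {ρ σ} xs {ys} → Agree ρ σ (xs ++ ys) → Agree ρ σ ys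
    Agree-++ʳ xs h p = h (∈-++⁺ʳ xs p)

    update-other : ∀ ρ x d {y} → ¬ y ≡ x → update L M ρ x d y ≡ ρ y
    update-other ρ x d {y} y≢x with y ≟ x
    ... | yes y≡x = ⊥-elim (y≢x y≡x)
    ... | no  _   = refl

    mutual
      eval-agree : ∀ {ρ σ} t → Agree ρ σ (tvars L t) → eval L M ρ t ≡ eval L M σ t
      eval-agree (var x)    h = h (here refl)
      eval-agree (app f ts) h = cong (interp f) (evalVec-agree ts h)

      evalVec-agree : ∀ {n ρ σ} (ts : Vec (Term L) n) → Agree ρ σ (tvarsVec L ts) →
                      evalVec L M ρ ts ≡ evalVec L M σ ts
      evalVec-agree []       h = refl
      evalVec-agree (t ∷ ts) h =
        cong₂ _∷_ (eval-agree t (Agree-++ˡ (tvars L t) h))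
                  (evalVec-agree ts (Agree-++ʳ (tvars L t) h))

    Sat-agree : ∀ {ρ σ} E → Agree ρ σ (vars L E) → Sat L M ρ E → Sat L M σ E
    Sat-agree true     h _       = tt
    Sat-agree false    h ()
    Sat-agree (s ≐ t)  h s≡t     =
      trans (sym (eval-agree s (Agree-++ˡ (tvars L s) h)))
            (trans s≡t (eval-agree t (Agree-++ʳ (tvars L s) h)))
    Sat-agree (E ∧ F)  h (e , f) =
      Sat-agree E (Agree-++ˡ (vars L E) h) e , Sat-agree F (Agree-++ʳ (vars L E) h) f
    Sat-agree {ρ} {σ} (ex x E) h (d , e) = d , Sat-agree E h' e
      where
      h' : Agree (update L M ρ x d) (update L M σ x d) (vars L E)
      h' {y} p with y ≟ x
      ... | yes _   = refl
      ... | no  y≢x = h (∈-filter⁺ (λ z → ¬? (z ≟ x)) p y≢x)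

    Sat-exs⁻ : ∀ {ρ} zs E → Sat L M ρ (exs zs E) →
               ∃ λ σ → (∀ {y} → y ∉ zs → σ y ≡ ρ y) × Sat L M σ E
    Sat-exs⁻ {ρ} []       E e       = ρ , (λ _ → refl) , e
    Sat-exs⁻ {ρ} (z ∷ zs) E (d , e) with Sat-exs⁻ zs E e
    ... | σ , σ≈ρ , eσ =
      σ , (λ y∉ → trans (σ≈ρ (y∉ ∘ there)) (update-other ρ z d (y∉ ∘ here))) , eσ

    Sat-exs⁺ : ∀ {ρ σ} zs E → (∀ {y} → y ∈ vars L E → y ∉ zs → σ y ≡ ρ y) →
               Sat L M σ E → Sat L M ρ (exs zs E)
    Sat-exs⁺ []       E h e = Sat-agree E (λ p → h p λ ()) e
    Sat-exs⁺ {ρ} {σ} (z ∷ zs) E h e = σ z , Sat-exs⁺ zs E h' e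
      where
      h' : ∀ {y} → y ∈ vars L E → y ∉ zs → σ y ≡ update L M ρ z (σ z) y
      h' {y} p y∉zs with y ≟ z
      ... | yes refl = refl
      ... | no  y≢z  = h p λ { (here y≡z) → y≢z y≡z ; (there q) → y∉zs q }

    Sat-exs-mono : ∀ {ρ} zs zs' E E' → (∀ {σ} → Sat L M σ E → Sat L M σ E') →
                   (∀ {y} → y ∈ vars L E' → y ∈ zs → y ∈ zs') →
                   Sat L M ρ (exs zs E) → Sat L M ρ (exs zs' E')
    Sat-exs-mono zs zs' E E' E→E' free e with Sat-exs⁻ zs E e
    ... | σ , σ≈ρ , eσ = Sat-exs⁺ zs' E' (λ p y∉zs' → σ≈ρ (y∉zs' ∘ free p)) (E→E' eσ)

  ∣-mono-⪯ : ∀ {E E'} X → _⪯_ L E E' → _⪯_ L (_∣_ L E X) (_∣_ L E' X)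
  ∣-mono-⪯ {E} {E'} X E⪯E' M model ρ
    rewrite ∣≡exs-projVars E X | ∣≡exs-projVars E' X =
    Sat-exs-mono M (projVars L E X) (projVars L E' X) E E'
                 (E⪯E' M model _) (projVars-transfer E E')

lemma5p4 : (L : Language) (E E' : EForm L) (X : List ℕ) →
           (_⪯_ L E E' → _⪯_ L (_∣_ L E X) (_∣_ L E' X))
           × (_≈_ L E E' → _≈_ L (_∣_ L E X) (_∣_ L E' X))
lemma5p4 L E E' X = ∣-mono-⪯ L X , ∣-cong-≈
  where
  ∣-cong-≈ : _≈_ L E E' → _≈_ L (_∣_ L E X) (_∣_ L E' X)
  ∣-cong-≈ E≈E' M model ρ =
    ∣-mono-⪯ L X (λ M model ρ → proj₁ (E≈E' M model ρ)) M model ρ ,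
    ∣-mono-⪯ L X (λ M model ρ → proj₂ (E≈E' M model ρ)) M model ρ
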